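{- Let $s\ge1$ be an integer and let $S\subseteq\{0,1,\dots,s\}$ with $0\in S$. Let $\alpha$ be the minimum of $w(\gamma)/|\gamma|$ over all cycles $\gamma$ in the weighted directed graph $G_S$ defined below. Then $\tau(S)=\alpha$, and there is a periodic set $T\subseteq\mathbb Z$ with $T+S=\mathbb Z$ whose density equals $\tau(S)$. In particular, $\tau(S)$ is rational.
   Context: For a finite non-empty $S\subset\mathbb Z$ and $n\ge1$, $\tau(S,n)=\min\{|T|:T\subseteq\mathbb Z,\ T+S\supseteq\{1,\dots,n\}\}$, and the covering density is $\tau(S)=\lim_{n\to\infty}\tau(S,n)/n$ (the limit exists and equals $\inf_{n\ge1}\tau(S,n)/n$). A set $T\subseteq\mathbb Z$ is periodic with period $\ell\ge1$ if $T+\ell=T$; its density is then $|T\cap\{0,\dots,\ell-1\}|/\ell$. The graph $G_S$: the vertex set is the power set of $\{1,\dots,s\}$; for a vertex $A$ write $A-1=\{a-1:a\in A\}$. There is a directed edge of weight $0$ from $A$ to $B$ if and only if $s+1\in A+S$ and $B=(A-1)\setminus\{0\}$, and a directed edge of weight $1$ from $A$ to $B$ if $B=((A-1)\setminus\{0\})\cup\{s\}$. A cycle is a directed closed walk $v_0v_1\cdots v_{m-1}v_0$ with $v_0,\dots,v_{m-1}$ distinct; $|\gamma|$ is its number of edges and $w(\gamma)$ the sum of its edge weights. -}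

module Defs where

open import Data.Nat using (ℕ; zero; suc; _≤_; _<_)
open import Data.Nat.DivMod using (_%_; m%n<n)
open import Data.Integer using (ℤ; +_) renaming (_+_ to _+ℤ_)
open import Data.Rational using (ℚ; _/_; _-_; ∣_∣; 0ℚ) renaming (_<_ to _<ℚ_; _≤_ to _≤ℚ_)
open import Data.Fin using (Fin; toℕ; fromℕ<)
open import Data.Fin.Subset using (Subset) renaming (_∈_ to _∈ₛ_; ∣_∣ to count)
open import Data.Vec using (Vec; lookup)
open import Data.Bool using (Bool; true; false)
open import Data.List using (List; length)
open import Data.List.Membership.Propositional using (_∈_)
open import Data.List.Relation.Unary.Unique.Propositional using (Unique)
open import Data.Product using (Σ; _×_; ∃)
open import Relation.Binary.PropositionalEquality using (_≡_; _≢_)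
open import Relation.Nullary using (¬_)
open import Function.Bundles using (_⇔_)
open import Function.Definitions using (Injective)

-- The set S ⊆ {0,…,s} is given as a list of naturals (duplicates are
-- irrelevant); its elements are regarded as integers via +_.

-- τ(S,n):  IsTau S n k  means  τ(S,n) = k, i.e. k is the minimum size of
-- a set T ⊆ ℤ with T + S ⊇ {1,…,n}.  Finite sets T are duplicate-free
-- lists (so |T| = length T); infinite T never realise the minimum.

Covers : List ℤ → List ℕ → ℕ → Set
Covers T S n = ∀ (x : ℕ) → 1 ≤ x → x ≤ n →
  Σ ℤ λ t → t ∈ T × Σ ℕ λ a → a ∈ S × + x ≡ t +ℤ + a

IsTau : List ℕ → ℕ → ℕ → Set
IsTau S n k =
  (Σ (List ℤ) λ T → Unique T × length T ≡ k × Covers T S n) ×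
  (∀ (T : List ℤ) → Unique T → Covers T S n → k ≤ length T)

TauEquals : List ℕ → ℚ → Set
TauEquals S α =
  (∀ (m : ℕ) → Σ ℕ λ k → IsTau S (suc m) k) ×
  (∀ (ε : ℚ) → 0ℚ <ℚ ε → Σ ℕ λ N → ∀ (m : ℕ) → N ≤ m → ∀ (k : ℕ) →
     IsTau S (suc m) k → ∣ ((+ k) / suc m) - α ∣ <ℚ ε)

-- The graph G_S.  A vertex is a subset A of {1,…,s}, encoded as a
-- Subset s, where index i : Fin s stands for the number i+1.

memN : ∀ {s} → Subset s → ℕ → Set
memN {s} A x = Σ (Fin s) λ i → suc (toℕ i) ≡ x × i ∈ₛ A

SumHits : (s : ℕ) → List ℕ → Subset s → Set
SumHits s S A = Σ ℕ λ a → memN A a × Σ ℕ λ c → c ∈ S × suc s ≡ a Data.Nat.+ c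
  where import Data.Nat

-- Edge s S A w B : there is an edge of weight w from A to B.
-- weight 0:  s+1 ∈ A+S  and  B = (A-1) \ {0}
-- weight 1:  B = ((A-1) \ {0}) ∪ {s}
Edge : (s : ℕ) → List ℕ → Subset s → Bool → Subset s → Set
Edge s S A false B = SumHits s S A × (∀ (x : ℕ) → memN B x ⇔ (x ≢ 0 × memN A (suc x)))
Edge s S A true  B = ∀ (x : ℕ) → memN B x ⇔ ((x ≢ 0 × memN A (suc x)) Data.Sum.⊎ x ≡ s)
  where import Data.Sum

next : ∀ {n} → Fin (suc n) → Fin (suc n)
next {n} i = fromℕ< (m%n<n (suc (toℕ i)) (suc n))

-- A cycle v₀ v₁ ⋯ v_{m-1} v₀ with m = suc len-1 edges, distinct vertices,
-- and wt[i] the weight of the edge v_i → v_{i+1 mod m}.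
record Cycle (s : ℕ) (S : List ℕ) : Set where
  field
    len-1    : ℕ
    v        : Fin (suc len-1) → Subset s
    wt       : Vec Bool (suc len-1)
    distinct : Injective _≡_ _≡_ v
    edges    : ∀ (i : Fin (suc len-1)) → Edge s S (v i) (lookup wt i) (v (next i))

ratio : ∀ {s S} → Cycle s S → ℚ
ratio γ = (+ count (Cycle.wt γ)) / suc (Cycle.len-1 γ)

IsMinRatio : (s : ℕ) → List ℕ → ℚ → Set
IsMinRatio s S α = (Σ (Cycle s S) λ γ → ratio γ ≡ α) × (∀ (γ : Cycle s S) → α ≤ℚ ratio γ)

Periodic : (ℤ → Bool) → ℕ → Set
Periodic T ℓ = ∀ (x : ℤ) → T (x +ℤ + ℓ) ≡ T x

SumsetIsZ : (ℤ → Bool) → List ℕ → Set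
SumsetIsZ T S = ∀ (x : ℤ) → Σ ℤ λ t → T t ≡ true × Σ ℕ λ a → a ∈ S × x ≡ t +ℤ + a

countUpTo : (ℤ → Bool) → ℕ → ℕ
countUpTo T zero = zero
countUpTo T (suc n) with T (+ n)
... | true  = suc (countUpTo T n)
... | false = countUpTo T n

density : (ℤ → Bool) → (p : ℕ) → ℚ
density T p = (+ countUpTo T (suc p)) / suc p

-- Encode T ⊆ ℤ by its indicator word and read the word through a sliding window of width s:
-- a covering of {1,…,n} becomes a walk of length n in G_S whose weight counts the elements of T
-- it uses, and every such walk comes from a covering. Cutting a walk at a repeated vertex splits
-- off a closed walk, with weights and lengths adding up; by the mediant inequality some simple
-- cycle is at least as cheap per step as any closed walk, and as G_S has 2^s vertices every walk
-- of length n has weight at least α n − 2^s. Conversely, repeating a cheapest cycle forever gives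
-- a periodic T with T + S = ℤ of density α, and coverings of {1,…,n} of size α n + O(1).

module Submission where

open import Data.Bool as Bool using (Bool; true; false)
open import Data.Empty using (⊥-elim)
open import Data.Fin as Fin using (Fin; toℕ; fromℕ<; funToFin; finToFun) renaming (zero to fzero; suc to fsuc)
open import Data.Fin.Properties as Finₚ
  using (toℕ-fromℕ<; fromℕ<-toℕ; toℕ<n; toℕ-injective; finToFun-funToFin; pigeonhole)
open import Data.Fin.Subset using (Subset) renaming (∣_∣ to count)
open import Data.Fin.Subset.Properties using (∣p∣≤n)
open import Data.Integer as ℤ using (ℤ; +_; _⊖_)
import Data.Integer.Properties as ℤₚ
open import Data.Integer.Tactic.RingSolver using () renaming (solve-∀ to ℤ-solve-∀)
open import Data.List using (List; []; _∷_; map; _++_; length; cartesianProduct; upTo)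
open import Data.List.Membership.DecPropositional ℤ._≟_ using (_∈?_)
open import Data.List.Membership.Propositional using (_∈_; find; lose)
open import Data.List.Membership.Propositional.Properties
  using (∈-++⁺ˡ; ∈-++⁺ʳ; ∈-++⁻; ∈-map⁺; ∈-∃++; ∈-cartesianProduct⁺; ∈-upTo⁺)
open import Data.List.Properties using (length-++)
open import Data.List.Relation.Unary.All as All using (All)
open import Data.List.Relation.Unary.AllPairs using ([]; _∷_)
open import Data.List.Relation.Unary.Any using (here; there; any?)
open import Data.List.Relation.Unary.Unique.Propositional using (Unique)
open import Data.Nat using (ℕ; zero; suc; pred; NonZero; >-nonZero; _+_; _*_; _∸_; _^_; _≤_; _<_; z≤n; s≤s; _≤?_; _<?_)
open import Data.Nat.Coprimality using (Coprime)
open import Data.Nat.DivMod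
  using (_div_; _%_; m%n<n; m≡m%n+[m/n]*n; m/n*n≤m; m<n⇒m%n≡m; n%n≡0; %-distribˡ-+; m%n%n≡m%n; [m+n]%n≡m%n)
open import Data.Nat.Induction using (<-rec)
open import Data.Nat.Properties
open import Algebra.Properties.CommutativeSemigroup +-commutativeSemigroup using ()
  renaming (x∙yz≈y∙xz to +-left-comm; xy∙z≈xz∙y to +-right-comm)
open import Algebra.Properties.CommutativeSemigroup *-commutativeSemigroup using ()
  renaming (xy∙z≈xz∙y to *-right-comm)
open import Data.Nat.Tactic.RingSolver using (solve-∀)
open import Data.Product using (Σ; ∃; _×_; _,_; proj₁; proj₂)
open import Data.Rational using (ℚ; mkℚ; _/_; _-_; ∣_∣; 0ℚ; toℚᵘ) renaming (_<_ to _<ℚ_; _≤_ to _≤ℚ_)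
import Data.Rational as ℚ
open import Data.Rational.Properties
  using (toℚᵘ-cancel-≤; toℚᵘ-cancel-<; toℚᵘ-fromℚᵘ; toℚᵘ-homo-∣-∣; toℚᵘ-homo-+; toℚᵘ-homo‿-)
open import Data.Rational.Unnormalised as ℚᵘ using (mkℚᵘ; *≤*; *<*; _≃_)
import Data.Rational.Unnormalised.Properties as ℚᵘₚ
open import Data.Sum as Sum using (_⊎_; inj₁; inj₂; [_,_]′)
open import Data.Vec using (Vec; []; _∷_; lookup; tabulate)
open import Data.Vec.Properties using (tabulate∘lookup; tabulate-cong; lookup∘tabulate; []=⇒lookup; lookup⇒[]=; ≡-dec)
open import Defs
open import Function using (id)
open import Function.Bundles using (mk⇔; Equivalence)
open import Relation.Binary.Definitions using (tri<; tri≈; tri>)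
open import Relation.Binary.PropositionalEquality
open import Relation.Nullary using (¬_; Dec; yes; no; does)
import Relation.Nullary.Decidable as Dec
open import Relation.Nullary.Decidable using (_×-dec_)

bit : Bool → ℕ
bit false = 0
bit true  = 1

trues : (ℕ → Bool) → ℕ → ℕ
trues f zero    = 0
trues f (suc n) = bit (f n) + trues f n

trues-cong : ∀ {f g} n → (∀ {k} → k < n → f k ≡ g k) → trues f n ≡ trues g n
trues-cong zero    f≗g = refl
trues-cong (suc n) f≗g =
  cong₂ _+_ (cong bit (f≗g ≤-refl)) (trues-cong n (λ k<n → f≗g (m<n⇒m<1+n k<n)))

trues-+ : ∀ f m n → trues f (m + n) ≡ trues f m + trues (λ k → f (m + k)) n
trues-+ f m zero    = trans (cong (trues f) (+-identityʳ m)) (sym (+-identityʳ _))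
trues-+ f m (suc n) = begin
  trues f (m + suc n)                                              ≡⟨ cong (trues f) (+-suc m n) ⟩
  bit (f (m + n)) + trues f (m + n)                                ≡⟨ cong (_+_ (bit (f (m + n)))) (trues-+ f m n) ⟩
  bit (f (m + n)) + (trues f m + trues (λ k → f (m + k)) n)        ≡⟨ +-left-comm (bit (f (m + n))) (trues f m) _ ⟩
  trues f m + (bit (f (m + n)) + trues (λ k → f (m + k)) n)        ∎
  where open ≡-Reasoning

trues-suc : ∀ f n → trues f (suc n) ≡ bit (f 0) + trues (λ k → f (suc k)) n
trues-suc f n = trans (trues-+ f 1 n) (cong (_+ trues (λ k → f (suc k)) n) (+-identityʳ (bit (f 0))))

count≡trues : ∀ {n} (v : Vec Bool n) {g : ℕ → Bool} → (∀ i → lookup v i ≡ g (toℕ i)) → count v ≡ trues g n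
count≡trues []                _     = refl
count≡trues {suc n} (x ∷ v) {g} v≗g = begin
  count (x ∷ v)                          ≡⟨ count-∷ x ⟩
  bit x + count v                        ≡⟨ cong₂ _+_ (cong bit (v≗g fzero)) (count≡trues v (λ i → v≗g (fsuc i))) ⟩
  bit (g 0) + trues (λ k → g (suc k)) n  ≡⟨ trues-suc g n ⟨
  trues g (suc n)                        ∎
  where
  open ≡-Reasoning
  count-∷ : ∀ x → count (x ∷ v) ≡ bit x + count v
  count-∷ false = refl
  count-∷ true  = refl

trues-mono : ∀ f {m n} → m ≤ n → trues f m ≤ trues f n
trues-mono f {m} {n} m≤n = begin
  trues f m                                          ≤⟨ m≤m+n _ _ ⟩
  trues f m + trues (λ k → f (m + k)) (n ∸ m)         ≡⟨ trues-+ f m (n ∸ m) ⟨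
  trues f (m + (n ∸ m))                              ≡⟨ cong (trues f) (m+[n∸m]≡n m≤n) ⟩
  trues f n                                          ∎
  where open ≤-Reasoning

module _ {f : ℕ → Bool} {m : ℕ} (periodic : ∀ k → f (k + m) ≡ f k) where

  trues-period-shift : ∀ n → trues (λ k → f (m + k)) n ≡ trues f n
  trues-period-shift n = trues-cong n (λ {k} _ → trans (cong f (+-comm m k)) (periodic k))

  trues-periods : ∀ q r → trues f (q * m + r) ≡ q * trues f m + trues f r
  trues-periods zero    r = refl
  trues-periods (suc q) r = begin
    trues f (m + q * m + r)                          ≡⟨ cong (trues f) (+-assoc m (q * m) r) ⟩
    trues f (m + (q * m + r))                        ≡⟨ trues-+ f m (q * m + r) ⟩
    trues f m + trues (λ k → f (m + k)) (q * m + r)  ≡⟨ cong (_+_ (trues f m)) (trues-period-shift (q * m + r)) ⟩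
    trues f m + trues f (q * m + r)                  ≡⟨ cong (_+_ (trues f m)) (trues-periods q r) ⟩
    trues f m + (q * trues f m + trues f r)          ≡⟨ +-assoc (trues f m) _ _ ⟨
    suc q * trues f m + trues f r                    ∎
    where open ≡-Reasoning

  trues-window : ∀ i → trues (λ k → f (i + k)) m ≡ trues f m
  trues-window i = +-cancelˡ-≡ (trues f i) _ _ (begin
    trues f i + trues (λ k → f (i + k)) m            ≡⟨ trues-+ f i m ⟨
    trues f (i + m)                                  ≡⟨ cong (trues f) (+-comm i m) ⟩
    trues f (m + i)                                  ≡⟨ trues-+ f m i ⟩
    trues f m + trues (λ k → f (m + k)) i            ≡⟨ cong (_+_ (trues f m)) (trues-period-shift i) ⟩
    trues f m + trues f i                            ≡⟨ +-comm (trues f m) (trues f i) ⟩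
    trues f i + trues f m                            ∎)
    where open ≡-Reasoning

  trues-periodic-≤ : .{{_ : NonZero m}} → ∀ n → m * trues f n ≤ trues f m * (n + m)
  trues-periodic-≤ n = begin
    m * trues f n                                    ≡⟨ cong (λ k → m * trues f k) n≡ ⟩
    m * trues f (q * m + n % m)                      ≡⟨ cong (m *_) (trues-periods q (n % m)) ⟩
    m * (q * c + trues f (n % m))                    ≤⟨ *-monoʳ-≤ m (+-monoʳ-≤ (q * c) (trues-mono f (<⇒≤ (m%n<n n m)))) ⟩
    m * (q * c + c)                                  ≡⟨ rearrange m q c ⟩
    c * (q * m + m)                                  ≤⟨ *-monoʳ-≤ c (+-monoˡ-≤ m (m/n*n≤m n m)) ⟩
    c * (n + m)                                      ∎
    where
    open ≤-Reasoning
    q = n div m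
    c = trues f m
    n≡ : n ≡ q * m + n % m
    n≡ = trans (m≡m%n+[m/n]*n n m) (+-comm (n % m) (q * m))
    rearrange : ∀ m q c → m * (q * c + c) ≡ c * (q * m + m)
    rearrange = solve-∀

-- Exhaustive search over finite prefixes

AgreeBelow : ℕ → (ℕ → Bool) → (ℕ → Bool) → Set
AgreeBelow N f g = ∀ {k} → k < N → f k ≡ g k

cons : Bool → (ℕ → Bool) → ℕ → Bool
cons x f zero    = x
cons x f (suc k) = f k

sequences : ℕ → List (ℕ → Bool)
sequences zero    = (λ _ → false) ∷ []
sequences (suc N) = map (cons false) (sequences N) ++ map (cons true) (sequences N)

sequences-complete : ∀ N g → ∃ λ f → f ∈ sequences N × AgreeBelow N f g
sequences-complete zero    g = _ , here refl , λ ()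
sequences-complete (suc N) g with f , f∈ , f≈g ← sequences-complete N (λ k → g (suc k)) =
  cons (g 0) f , cons∈ (g 0) , agree
  where
  cons∈ : ∀ x → cons x f ∈ sequences (suc N)
  cons∈ false = ∈-++⁺ˡ (∈-map⁺ (cons false) f∈)
  cons∈ true  = ∈-++⁺ʳ (map (cons false) (sequences N)) (∈-map⁺ (cons true) f∈)
  agree : AgreeBelow (suc N) (cons (g 0) f) g
  agree {zero}  _         = refl
  agree {suc k} (s≤s k<N) = f≈g k<N

module Minimum {A : Set} {P : A → Set} (P? : ∀ x → Dec (P x))
               (_≼_ : A → A → Set) (≼-total : ∀ x y → x ≼ y ⊎ y ≼ x)
               (≼-trans : ∀ {x y z} → x ≼ y → y ≼ z → x ≼ z) where

  LowerBound : List A → A → Set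
  LowerBound xs x = ∀ {y} → y ∈ xs → P y → x ≼ y

  private
    ≼-refl : ∀ {x} → x ≼ x
    ≼-refl {x} = [ id , id ]′ (≼-total x x)

    minimum⊎ : ∀ xs → (∃ λ x → P x × LowerBound xs x) ⊎ (∀ {y} → y ∈ xs → ¬ P y)
    minimum⊎ [] = inj₂ λ ()
    minimum⊎ (x ∷ xs) with P? x | minimum⊎ xs
    ... | no ¬px | inj₂ none = inj₂ λ { (here refl) → ¬px ; (there y∈) → none y∈ }
    ... | no ¬px | inj₁ (z , pz , z≼) =
      inj₁ (z , pz , λ { (here refl) py → ⊥-elim (¬px py) ; (there y∈) → z≼ y∈ })
    ... | yes px | inj₂ none =
      inj₁ (x , px , λ { (here refl) _ → ≼-refl ; (there y∈) py → ⊥-elim (none y∈ py) })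
    ... | yes px | inj₁ (z , pz , z≼) with ≼-total x z
    ...   | inj₁ x≼z = inj₁ (x , px , λ { (here refl) _ → ≼-refl ; (there y∈) py → ≼-trans x≼z (z≼ y∈ py) })
    ...   | inj₂ z≼x = inj₁ (z , pz , λ { (here refl) _ → z≼x ; (there y∈) → z≼ y∈ })

  minimum : ∀ xs → (∃ λ x → x ∈ xs × P x) → ∃ λ x → P x × LowerBound xs x
  minimum xs (x , x∈ , px) with minimum⊎ xs
  ... | inj₁ min  = min
  ... | inj₂ none = ⊥-elim (none x∈ px)

infix 4 _÷_≼_÷_

record _÷_≼_÷_ (a m b n : ℕ) : Set where
  constructor cross
  field cross-≤ : a * n ≤ b * m

open _÷_≼_÷_ public

≼-trans : ∀ {a m b c k} n .{{_ : NonZero n}} → a ÷ m ≼ b ÷ n → b ÷ n ≼ c ÷ k → a ÷ m ≼ c ÷ k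
≼-trans {a} {m} {b} {c} {k} n (cross a≼b) (cross b≼c) = cross (*-cancelʳ-≤ (a * k) (c * m) n (begin
  a * k * n    ≡⟨ *-right-comm a k n ⟩
  a * n * k    ≤⟨ *-monoˡ-≤ k a≼b ⟩
  b * m * k    ≡⟨ *-right-comm b m k ⟩
  b * k * m    ≤⟨ *-monoˡ-≤ m b≼c ⟩
  c * n * m    ≡⟨ *-right-comm c n m ⟩
  c * m * n    ∎))
  where open ≤-Reasoning

mediant : ∀ a m b n → a ÷ m ≼ (a + b) ÷ (m + n) ⊎ b ÷ n ≼ (a + b) ÷ (m + n)
mediant a m b n with ≤-total (a * n) (b * m)
... | inj₁ an≤bm = inj₁ (cross (begin
  a * (m + n)        ≡⟨ *-distribˡ-+ a m n ⟩
  a * m + a * n      ≤⟨ +-monoʳ-≤ (a * m) an≤bm ⟩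
  a * m + b * m      ≡⟨ *-distribʳ-+ m a b ⟨
  (a + b) * m        ∎))
  where open ≤-Reasoning
... | inj₂ bm≤an = inj₂ (cross (begin
  b * (m + n)        ≡⟨ *-distribˡ-+ b m n ⟩
  b * m + b * n      ≤⟨ +-monoˡ-≤ (b * n) bm≤an ⟩
  a * n + b * n      ≡⟨ *-distribʳ-+ n a b ⟨
  (a + b) * n        ∎))
  where open ≤-Reasoning

bitFin : Bool → Fin 2
bitFin false = fzero
bitFin true  = fsuc fzero

bitFin-injective : ∀ {x y} → bitFin x ≡ bitFin y → x ≡ y
bitFin-injective {false} {false} _ = refl
bitFin-injective {true}  {true}  _ = refl

encode : ∀ {n} → Subset n → Fin (2 ^ n)
encode A = funToFin (λ i → bitFin (lookup A i))

encode-injective : ∀ {n} {A B : Subset n} → encode A ≡ encode B → A ≡ B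
encode-injective {A = A} {B} eq = begin
  A                      ≡⟨ tabulate∘lookup A ⟨
  tabulate (lookup A)    ≡⟨ tabulate-cong (λ i → bitFin-injective (lookup-bits i)) ⟩
  tabulate (lookup B)    ≡⟨ tabulate∘lookup B ⟩
  B                      ∎
  where
  open ≡-Reasoning
  lookup-bits : ∀ i → bitFin (lookup A i) ≡ bitFin (lookup B i)
  lookup-bits i = begin
    bitFin (lookup A i)      ≡⟨ finToFun-funToFin _ i ⟨
    finToFun (encode A) i    ≡⟨ cong (λ e → finToFun e i) eq ⟩
    finToFun (encode B) i    ≡⟨ finToFun-funToFin _ i ⟩
    bitFin (lookup B i)      ∎

subset-pigeonhole : ∀ {m n} → 2 ^ n < m → (f : Fin m → Subset n) → ∃ λ i → ∃ λ j → i Fin.< j × f i ≡ f j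
subset-pigeonhole 2ⁿ<m f with i , j , i<j , eq ← pigeonhole 2ⁿ<m (λ i → encode (f i)) =
  i , j , i<j , encode-injective eq

injective⇒≤2^ : ∀ {m n} (f : Fin m → Subset n) → (∀ {i j} → f i ≡ f j → i ≡ j) → m ≤ 2 ^ n
injective⇒≤2^ {m} {n} f f-inj with m ≤? 2 ^ n
... | yes m≤2ⁿ = m≤2ⁿ
... | no  m≰2ⁿ with i , j , i<j , eq ← subset-pigeonhole (≰⇒> m≰2ⁿ) f =
  ⊥-elim (Finₚ.<-irrefl (f-inj eq) i<j)

Unique-⊆⇒length≤ : ∀ {A : Set} {xs ys : List A} → Unique xs → (∀ {x} → x ∈ xs → x ∈ ys) → length xs ≤ length ys
Unique-⊆⇒length≤ {xs = []}     _          _    = z≤n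
Unique-⊆⇒length≤ {xs = x ∷ xs} (x∉ ∷ uniq) xs⊆ys with ys₁ , ys₂ , refl ← ∈-∃++ (xs⊆ys (here refl)) = begin
  suc (length xs)              ≤⟨ s≤s (Unique-⊆⇒length≤ uniq xs⊆ys₁ys₂) ⟩
  suc (length (ys₁ ++ ys₂))    ≡⟨ cong suc (length-++ ys₁) ⟩
  suc (length ys₁ + length ys₂) ≡⟨ +-suc (length ys₁) (length ys₂) ⟨
  length ys₁ + length (x ∷ ys₂) ≡⟨ length-++ ys₁ ⟨
  length (ys₁ ++ x ∷ ys₂)      ∎
  where
  open ≤-Reasoning
  xs⊆ys₁ys₂ : ∀ {y} → y ∈ xs → y ∈ ys₁ ++ ys₂
  xs⊆ys₁ys₂ {y} y∈ with ∈-++⁻ ys₁ (xs⊆ys (there y∈))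
  ... | inj₁ y∈ys₁         = ∈-++⁺ˡ y∈ys₁
  ... | inj₂ (here refl)   = ⊥-elim (All.lookup x∉ y∈ refl)
  ... | inj₂ (there y∈ys₂) = ∈-++⁺ʳ ys₁ y∈ys₂

toℚᵘ-fraction : ∀ a m → toℚᵘ ((+ a) / suc m) ≃ mkℚᵘ (+ a) m
toℚᵘ-fraction a m = toℚᵘ-fromℚᵘ (mkℚᵘ (+ a) m)

fraction-≤ : ∀ a m c n → a ÷ suc m ≼ c ÷ suc n → (+ a) / suc m ≤ℚ (+ c) / suc n
fraction-≤ a m c n (cross a≼c) = toℚᵘ-cancel-≤
  (ℚᵘₚ.≤-respˡ-≃ (ℚᵘₚ.≃-sym (toℚᵘ-fraction a m)) (ℚᵘₚ.≤-respʳ-≃ (ℚᵘₚ.≃-sym (toℚᵘ-fraction c n)) (*≤* cross-ℤ)))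
  where
  cross-ℤ : + a ℤ.* + suc n ℤ.≤ + c ℤ.* + suc m
  cross-ℤ = subst₂ ℤ._≤_ (ℤₚ.pos-* a (suc n)) (ℤₚ.pos-* c (suc m)) (ℤ.+≤+ a≼c)

∣⊖∣≤ : ∀ {a b E} → a ≤ b + E → b ≤ a + E → ℤ.∣ a ⊖ b ∣ ≤ E
∣⊖∣≤ {a} {b} {E} a≤b+E b≤a+E with b ≤? a
... | yes b≤a = subst (λ z → ℤ.∣ z ∣ ≤ E) (sym (ℤₚ.⊖-≥ b≤a))
                  (subst (a ∸ b ≤_) (m+n∸m≡n b E) (∸-monoˡ-≤ b a≤b+E))
... | no  b≰a = subst (λ z → ℤ.∣ z ∣ ≤ E) (sym (ℤₚ.⊖-< (≰⇒> b≰a)))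
                  (subst (_≤ E) (sym (ℤₚ.∣-i∣≡∣i∣ (+ (b ∸ a))))
                    (subst (b ∸ a ≤_) (m+n∸m≡n a E) (∸-monoˡ-≤ a b≤a+E)))

close-fractions : ∀ k n c m e d .(cop : Coprime (suc e) (suc d)) →
  ℤ.∣ k * suc m ⊖ c * suc n ∣ * suc d < suc e * (suc n * suc m) →
  ∣ (+ k) / suc n - (+ c) / suc m ∣ <ℚ mkℚ (+ suc e) d cop
close-fractions k n c m e d cop close = toℚᵘ-cancel-< (ℚᵘₚ.<-respˡ-≃ (ℚᵘₚ.≃-sym toℚᵘ-distance) (*<* close′))
  where
  x = (+ k) / suc n
  y = (+ c) / suc m
  toℚᵘ-distance : toℚᵘ ∣ x - y ∣ ≃ ℚᵘ.∣ mkℚᵘ (+ k) n ℚᵘ.- mkℚᵘ (+ c) m ∣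
  toℚᵘ-distance = ℚᵘₚ.≃-trans (toℚᵘ-homo-∣-∣ (x - y)) (ℚᵘₚ.∣-∣-cong (ℚᵘₚ.≃-trans (toℚᵘ-homo-+ x (ℚ.- y))
    (ℚᵘₚ.+-cong (toℚᵘ-fraction k n) (ℚᵘₚ.≃-trans (toℚᵘ-homo‿- y) (ℚᵘₚ.-‿cong (toℚᵘ-fraction c m))))))
  numerator : + k ℤ.* + suc m ℤ.+ ℤ.- + c ℤ.* + suc n ≡ k * suc m ⊖ c * suc n
  numerator = trans (cong₂ ℤ._+_ (sym (ℤₚ.pos-* k (suc m)))
                       (trans (sym (ℤₚ.neg-distribˡ-* (+ c) (+ suc n))) (cong ℤ.-_ (sym (ℤₚ.pos-* c (suc n))))))
                    (ℤₚ.m-n≡m⊖n (k * suc m) (c * suc n))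
  close′ : + ℤ.∣ + k ℤ.* + suc m ℤ.+ ℤ.- + c ℤ.* + suc n ∣ ℤ.* + suc d ℤ.< + suc e ℤ.* + (suc n * suc m)
  close′ = subst₂ ℤ._<_
    (trans (ℤₚ.pos-* ℤ.∣ k * suc m ⊖ c * suc n ∣ (suc d)) (cong (λ z → + ℤ.∣ z ∣ ℤ.* + suc d) (sym numerator)))
    (ℤₚ.pos-* (suc e) (suc n * suc m)) (ℤ.+<+ close)

fractions-converge : ∀ c L C (R : ℕ → ℕ → Set) →
  (∀ {n k} → R n k → ℤ.∣ k * suc L ⊖ c * suc n ∣ ≤ suc L * C) →
  ∀ ε → 0ℚ <ℚ ε → ∃ λ N → ∀ n → N ≤ n → ∀ k → R n k → ∣ (+ k) / suc n - (+ c) / suc L ∣ <ℚ ε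
fractions-converge c L C R bound (mkℚ (+ suc e) d cop) _ = C * suc d , λ n C[d+1]≤n k Rnk →
  close-fractions k n c L e d cop (begin-strict
    ℤ.∣ k * suc L ⊖ c * suc n ∣ * suc d   ≤⟨ *-monoˡ-≤ (suc d) (bound Rnk) ⟩
    suc L * C * suc d                     ≡⟨ *-assoc (suc L) C (suc d) ⟩
    suc L * (C * suc d)                   <⟨ *-monoʳ-< (suc L) (s≤s C[d+1]≤n) ⟩
    suc L * suc n                         ≡⟨ *-comm (suc L) (suc n) ⟩
    suc n * suc L                         ≤⟨ m≤n*m (suc n * suc L) (suc e) ⟩
    suc e * (suc n * suc L)               ∎)
  where open ≤-Reasoning
fractions-converge c L C R bound (mkℚ (+ zero) d _) (ℚ.*<* (ℤ.+<+ ()))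
fractions-converge c L C R bound (mkℚ ℤ.-[1+ _ ] d _) (ℚ.*<* ())

countUpTo≡trues : ∀ T n → countUpTo T n ≡ trues (λ k → T (+ k)) n
countUpTo≡trues T zero = refl
countUpTo≡trues T (suc n) with T (+ n)
... | true  = cong suc (countUpTo≡trues T n)
... | false = countUpTo≡trues T n

module PeriodicExtension (f : ℕ → Bool) (L : ℕ) (periodic : ∀ k → f (k + suc L) ≡ f k) where

  periodic-multiple : ∀ q k → f (k + q * suc L) ≡ f k
  periodic-multiple zero    k = cong f (+-identityʳ k)
  periodic-multiple (suc q) k =
    trans (cong f (trans (sym (+-assoc k (suc L) (q * suc L))) (+-right-comm k (suc L) (q * suc L))))
          (trans (periodic (k + q * suc L)) (periodic-multiple q k))

  -- −(n + 1) ≡ (n + 1) L modulo L + 1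
  extend : ℤ → Bool
  extend (+ n)      = f n
  extend ℤ.-[1+ n ] = f (suc n * L)

  extend-periodic : ∀ x → extend (x ℤ.+ + suc L) ≡ extend x
  extend-periodic (+ n)      = periodic n
  extend-periodic ℤ.-[1+ n ] with suc n ≤? suc L
  ... | yes (s≤s n≤L) = begin
    extend (suc L ⊖ suc n)       ≡⟨ cong extend (ℤₚ.⊖-≥ (s≤s n≤L)) ⟩
    f (L ∸ n)                    ≡⟨ periodic-multiple n (L ∸ n) ⟨
    f (L ∸ n + n * suc L)        ≡⟨ cong f (trans (regroup (L ∸ n) n L) (cong (_+ n * L) (m∸n+n≡m n≤L))) ⟩
    f (suc n * L)                ∎
    where
    open ≡-Reasoning
    regroup : ∀ a n L → a + n * suc L ≡ a + n + n * L
    regroup = solve-∀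
  ... | no  n≰L = begin
    extend (suc L ⊖ suc n)       ≡⟨ cong extend (trans (ℤₚ.⊖-< (≰⇒> n≰L)) (cong (λ z → ℤ.- (+ z)) (+-∸-assoc 1 L<n))) ⟩
    f (suc n′ * L)               ≡⟨ periodic-multiple L (suc n′ * L) ⟨
    f (suc n′ * L + L * suc L)   ≡⟨ cong f (trans (regroup n′ L) (cong (λ z → suc z * L) (m∸n+n≡m L<n))) ⟩
    f (suc n * L)                ∎
    where
    open ≡-Reasoning
    L<n : suc L ≤ n
    L<n = ≤-pred (≰⇒> n≰L)
    n′ = n ∸ suc L
    regroup : ∀ a L → suc a * L + L * suc L ≡ suc (a + suc L) * L
    regroup = solve-∀

  extend-multiple : ∀ q x → extend (x ℤ.+ + (q * suc L)) ≡ extend x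
  extend-multiple zero    x = cong extend (ℤₚ.+-identityʳ x)
  extend-multiple (suc q) x = begin
    extend (x ℤ.+ + (suc L + q * suc L))       ≡⟨ cong extend (regroup x (suc L) (q * suc L)) ⟩
    extend (x ℤ.+ + (q * suc L) ℤ.+ + suc L)   ≡⟨ extend-periodic (x ℤ.+ + (q * suc L)) ⟩
    extend (x ℤ.+ + (q * suc L))               ≡⟨ extend-multiple q x ⟩
    extend x                                   ∎
    where
    open ≡-Reasoning
    regroup : ∀ x a b → x ℤ.+ + (a + b) ≡ x ℤ.+ + b ℤ.+ + a
    regroup x a b = trans (cong (ℤ._+_ x) (trans (ℤₚ.pos-+ a b) (ℤₚ.+-comm (+ a) (+ b)))) (sym (ℤₚ.+-assoc x (+ b) (+ a)))

-- Words and walks in G_S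

Bool-ext : ∀ {x y} → (x ≡ true → y ≡ true) → (y ≡ true → x ≡ true) → x ≡ y
Bool-ext {false} {false} _   _   = refl
Bool-ext {false} {true}  _   y⇒x = y⇒x refl
Bool-ext {true}  {false} x⇒y _   = sym (x⇒y refl)
Bool-ext {true}  {true}  _   _   = refl

last-index : ∀ {n} → 1 ≤ n → ∃ λ y → suc y ≡ n
last-index (s≤s _) = _ , refl

module Covering (s : ℕ) (1≤s : 1 ≤ s) (S : List ℕ) (S≤s : All (_≤ s) S) (0∈S : 0 ∈ S) where

  -- Letter j of a word stands for the integer j + 1 − s, so the letters s, …, s + n − 1
  -- are the integers 1, …, n; the vertex of G_S reached after i steps is window b i.
  Word : Set
  Word = ℕ → Bool

  Covered : Word → ℕ → Set
  Covered b z = ∃ λ c → c ∈ S × c ≤ z × b (z ∸ c) ≡ true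

  CoveredUpTo : Word → ℕ → Set
  CoveredUpTo b n = ∀ {y} → y < n → Covered b (s + y)

  Closed : Word → ℕ → Set
  Closed b m = ∀ {k} → k < s → b (m + k) ≡ b k

  weight : Word → ℕ → ℕ
  weight b m = trues (λ k → b (s + k)) m

  window : Word → ℕ → Subset s
  window b i = tabulate (λ k → b (i + toℕ k))

  covered? : ∀ b z → Dec (Covered b z)
  covered? b z = Dec.map′ find (λ (_ , c∈S , h) → lose c∈S h)
    (any? (λ c → c ≤? z ×-dec b (z ∸ c) Bool.≟ true) S)

  coveredUpTo? : ∀ b n → Dec (CoveredUpTo b n)
  coveredUpTo? b = allUpTo? (λ y → covered? b (s + y))

  closed? : ∀ b m → Dec (Closed b m)
  closed? b m = allUpTo? (λ k → b (m + k) Bool.≟ b k) s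

  ∈S⇒≤s : ∀ {c} → c ∈ S → c ≤ s
  ∈S⇒≤s = All.lookup S≤s

  lookup-window : ∀ b i {y} (p : y < s) → lookup (window b i) (fromℕ< p) ≡ b (i + y)
  lookup-window b i p = trans (lookup∘tabulate _ (fromℕ< p)) (cong (λ z → b (i + z)) (toℕ-fromℕ< p))

  window-≡⁻ : ∀ {b i j} → window b i ≡ window b j → ∀ {k} → k < s → b (i + k) ≡ b (j + k)
  window-≡⁻ {b} {i} {j} eq p =
    trans (sym (lookup-window b i p)) (trans (cong (λ A → lookup A (fromℕ< p)) eq) (lookup-window b j p))

  window-≡⁺ : ∀ {b i j} → (∀ {k} → k < s → b (i + k) ≡ b (j + k)) → window b i ≡ window b j
  window-≡⁺ agree = tabulate-cong (λ k → agree (toℕ<n k))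

  memN⁻ : ∀ (A : Subset s) {x} → memN A x → ∃ λ y → x ≡ suc y × Σ (y < s) λ p → lookup A (fromℕ< p) ≡ true
  memN⁻ A (k , refl , k∈A) = toℕ k , refl , toℕ<n k , trans (cong (lookup A) (fromℕ<-toℕ k _)) ([]=⇒lookup k∈A)

  memN⁺ : ∀ (A : Subset s) {y} (p : y < s) → lookup A (fromℕ< p) ≡ true → memN A (suc y)
  memN⁺ A p A[y] = fromℕ< p , cong suc (toℕ-fromℕ< p) , lookup⇒[]= _ A A[y]

  memN-suc⁻ : ∀ (A : Subset s) {y} → memN A (suc y) → (p : y < s) → lookup A (fromℕ< p) ≡ true
  memN-suc⁻ A m p with _ , refl , _ , A[y] ← memN⁻ A m = A[y]

  ¬memN[1+s] : ∀ (A : Subset s) → ¬ memN A (suc s)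
  ¬memN[1+s] A (k , eq , _) = <-irrefl (suc-injective eq) (toℕ<n k)

  record Shift (A : Subset s) (w : Bool) (B : Subset s) : Set where
    field
      shift : ∀ {y} (p : y < s) (q : suc y < s) → lookup B (fromℕ< p) ≡ lookup A (fromℕ< q)
      last  : ∀ {y} (p : y < s) → suc y ≡ s → lookup B (fromℕ< p) ≡ w

  module _ {A w B} (sh : Shift A w B) where
    open Shift sh

    shift-memN : ∀ {x} → x ≢ 0 → memN A (suc x) → memN B x
    shift-memN x≢0 m with memN⁻ A m
    ... | zero  , refl , _ , _    = ⊥-elim (x≢0 refl)
    ... | suc y , refl , q , A[q] = memN⁺ B p (trans (shift p q) A[q])
      where p = <-trans (n<1+n y) q

    unshift-memN : ∀ {y} (p : y < s) (q : suc y < s) → lookup B (fromℕ< p) ≡ true → memN A (suc (suc y))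
    unshift-memN p q B[p] = memN⁺ A q (trans (sym (shift p q)) B[p])

  Shift⇒Edge : ∀ {A w B} → Shift A w B → (w ≡ false → SumHits s S A) → Edge s S A w B
  Shift⇒Edge {A} {true} {B} sh _ x = mk⇔ to from
    where
    to : memN B x → (x ≢ 0 × memN A (suc x)) ⊎ x ≡ s
    to m with y , refl , p , B[p] ← memN⁻ B m with suc y <? s
    ... | yes q = inj₁ ((λ ()) , unshift-memN sh p q B[p])
    ... | no  q = inj₂ (≤-antisym p (≮⇒≥ q))
    from : (x ≢ 0 × memN A (suc x)) ⊎ x ≡ s → memN B x
    from (inj₁ (x≢0 , m)) = shift-memN sh x≢0 m
    from (inj₂ refl) with y , 1+y≡s ← last-index 1≤s =
      subst (memN B) 1+y≡s (memN⁺ B (≤-reflexive 1+y≡s) (Shift.last sh (≤-reflexive 1+y≡s) 1+y≡s))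
  Shift⇒Edge {A} {false} {B} sh hits = hits refl , λ x → mk⇔ to (λ (x≢0 , m) → shift-memN sh x≢0 m)
    where
    to : ∀ {x} → memN B x → x ≢ 0 × memN A (suc x)
    to m with y , refl , p , B[p] ← memN⁻ B m with suc y <? s
    ... | yes q = (λ ()) , unshift-memN sh p q B[p]
    ... | no  q with () ← trans (sym B[p]) (Shift.last sh p (≤-antisym p (≮⇒≥ q)))

  Edge⇒Shift : ∀ {A w B} → Edge s S A w B → Shift A w B
  Edge⇒Shift {A} {true} {B} e = record { shift = shift ; last = last }
    where
    shift : ∀ {y} (p : y < s) (q : suc y < s) → lookup B (fromℕ< p) ≡ lookup A (fromℕ< q)
    shift {y} p q = Bool-ext to from
      where
      to : lookup B (fromℕ< p) ≡ true → lookup A (fromℕ< q) ≡ true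
      to B[p] with Equivalence.to (e (suc y)) (memN⁺ B p B[p])
      ... | inj₁ (_ , m) = memN-suc⁻ A m q
      ... | inj₂ 1+y≡s   = ⊥-elim (<-irrefl 1+y≡s q)
      from : lookup A (fromℕ< q) ≡ true → lookup B (fromℕ< p) ≡ true
      from A[q] = memN-suc⁻ B (Equivalence.from (e (suc y)) (inj₁ ((λ ()) , memN⁺ A q A[q]))) p
    last : ∀ {y} (p : y < s) → suc y ≡ s → lookup B (fromℕ< p) ≡ true
    last {y} p 1+y≡s = memN-suc⁻ B (Equivalence.from (e (suc y)) (inj₂ 1+y≡s)) p
  Edge⇒Shift {A} {false} {B} (_ , e) = record { shift = shift ; last = last }
    where
    shift : ∀ {y} (p : y < s) (q : suc y < s) → lookup B (fromℕ< p) ≡ lookup A (fromℕ< q)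
    shift {y} p q = Bool-ext
      (λ B[p] → memN-suc⁻ A (proj₂ (Equivalence.to (e (suc y)) (memN⁺ B p B[p]))) q)
      (λ A[q] → memN-suc⁻ B (Equivalence.from (e (suc y)) ((λ ()) , memN⁺ A q A[q])) p)
    last : ∀ {y} (p : y < s) → suc y ≡ s → lookup B (fromℕ< p) ≡ false
    last {y} p 1+y≡s with lookup B (fromℕ< p) in B[p]
    ... | false = refl
    ... | true  = ⊥-elim (¬memN[1+s] A (subst (λ z → memN A (suc z)) 1+y≡s
                    (proj₂ (Equivalence.to (e (suc y)) (memN⁺ B p B[p])))))

  window-shift : ∀ b t → Shift (window b t) (b (s + t)) (window b (suc t))
  window-shift b t = record { shift = shift ; last = last }
    where
    shift : ∀ {y} (p : y < s) (q : suc y < s) → lookup (window b (suc t)) (fromℕ< p) ≡ lookup (window b t) (fromℕ< q)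
    shift {y} p q = trans (lookup-window b (suc t) p)
      (trans (cong b (sym (+-suc t y))) (sym (lookup-window b t q)))
    last : ∀ {y} (p : y < s) → suc y ≡ s → lookup (window b (suc t)) (fromℕ< p) ≡ b (s + t)
    last {y} p 1+y≡s = trans (lookup-window b (suc t) p)
      (cong b (trans (sym (+-suc t y)) (trans (cong (_+_ t) 1+y≡s) (+-comm t s))))

  window-hits : ∀ b t → Covered b (s + t) → b (s + t) ≡ false → SumHits s S (window b t)
  window-hits b t (zero , _ , _ , b[s+t]) b[s+t]≡false with () ← trans (sym b[s+t]) b[s+t]≡false
  window-hits b t (suc c , c∈S , _ , b[s+t∸c]) _ =
    suc (s ∸ suc c) , memN⁺ (window b t) y<s (trans (lookup-window b t y<s) (trans (cong b t+y≡) b[s+t∸c])) ,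
    suc c , c∈S , cong suc (sym (m∸n+n≡m c<s))
    where
    c<s : suc c ≤ s
    c<s = ∈S⇒≤s c∈S
    y<s : s ∸ suc c < s
    y<s = ∸-monoʳ-< {s} {suc c} {0} (s≤s z≤n) c<s
    t+y≡ : t + (s ∸ suc c) ≡ s + t ∸ suc c
    t+y≡ = trans (sym (+-∸-assoc t c<s)) (cong (_∸ suc c) (+-comm t s))

  window-edge : ∀ b t → Covered b (s + t) → Edge s S (window b t) (b (s + t)) (window b (suc t))
  window-edge b t cov = Shift⇒Edge (window-shift b t) (window-hits b t cov)

  -- Cutting a closed walk out of a walk

  module Splice (b : Word) (i ℓ : ℕ) (repeat : ∀ {k} → k < s → b (i + k) ≡ b (i + ℓ + k)) where

    loop : Word
    loop k = b (i + k)

    -- The branches agree on [i, i + s) by repeat: rest k ≡ b k below i + s and rest k ≡ b (k + ℓ) from i on.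
    rest : Word
    rest k with k <? i + s
    ... | yes _ = b k
    ... | no  _ = b (k + ℓ)

    rest-below : ∀ {k} → k < i + s → rest k ≡ b k
    rest-below {k} k<i+s with k <? i + s
    ... | yes _    = refl
    ... | no  k≮i+s = ⊥-elim (k≮i+s k<i+s)

    rest-from : ∀ {k} → i ≤ k → rest k ≡ b (k + ℓ)
    rest-from {k} i≤k with k <? i + s
    ... | no  _     = refl
    ... | yes k<i+s = begin
      b k              ≡⟨ cong b i+d≡k ⟨
      b (i + d)        ≡⟨ repeat (+-cancelˡ-< i d s (subst (_< i + s) (sym i+d≡k) k<i+s)) ⟩
      b (i + ℓ + d)    ≡⟨ cong b (trans (+-right-comm i ℓ d) (cong (_+ ℓ) i+d≡k)) ⟩
      b (k + ℓ)        ∎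
      where
      open ≡-Reasoning
      d = k ∸ i
      i+d≡k : i + d ≡ k
      i+d≡k = m+[n∸m]≡n i≤k

    loop-closed : Closed loop ℓ
    loop-closed {k} k<s = trans (cong b (sym (+-assoc i ℓ k))) (sym (repeat k<s))

    loop-covered : ∀ {n} → i + ℓ ≤ n → CoveredUpTo b n → CoveredUpTo loop ℓ
    loop-covered i+ℓ≤n cov {y} y<ℓ with c , c∈S , _ , b[z] ← cov (<-≤-trans (+-monoʳ-< i y<ℓ) i+ℓ≤n) =
      c , c∈S , c≤s+y , trans (cong b index) b[z]
      where
      c≤s+y : c ≤ s + y
      c≤s+y = ≤-trans (∈S⇒≤s c∈S) (m≤m+n s y)
      index : i + (s + y ∸ c) ≡ s + (i + y) ∸ c
      index = trans (sym (+-∸-assoc i c≤s+y)) (cong (_∸ c) (+-left-comm i s y))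

    rest-covered : ∀ r → CoveredUpTo b (i + ℓ + r) → CoveredUpTo rest (i + r)
    rest-covered r cov {y} y<i+r with y <? i
    ... | yes y<i with c , c∈S , c≤ , b[z] ← cov (<-≤-trans y<i (≤-trans (m≤m+n i ℓ) (m≤m+n (i + ℓ) r))) =
      c , c∈S , c≤ , trans (rest-below z<i+s) b[z]
      where
      z<i+s : s + y ∸ c < i + s
      z<i+s = ≤-<-trans (m∸n≤m (s + y) c) (subst (s + y <_) (+-comm s i) (+-monoʳ-< s y<i))
    ... | no y≮i with c , c∈S , _ , b[z] ← cov (subst (y + ℓ <_) (sym (+-right-comm i ℓ r)) (+-monoˡ-< ℓ y<i+r)) =
      c , c∈S , c≤s+y , trans (rest-from i≤z) (trans (cong b index) b[z])
      where
      c≤s+y : c ≤ s + y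
      c≤s+y = ≤-trans (∈S⇒≤s c∈S) (m≤m+n s y)
      i≤z : i ≤ s + y ∸ c
      i≤z = ≤-trans (≮⇒≥ y≮i) (subst (_≤ s + y ∸ c) (m+n∸m≡n s y) (∸-monoʳ-≤ (s + y) (∈S⇒≤s c∈S)))
      index : s + y ∸ c + ℓ ≡ s + (y + ℓ) ∸ c
      index = trans (sym (+-∸-comm ℓ c≤s+y)) (cong (_∸ c) (+-assoc s y ℓ))

    rest-closed : ∀ r → Closed b (i + ℓ + r) → Closed rest (i + r)
    rest-closed r closed {k} k<s = begin
      rest (i + r + k)        ≡⟨ rest-from (≤-trans (m≤m+n i r) (m≤m+n (i + r) k)) ⟩
      b (i + r + k + ℓ)       ≡⟨ cong b (trans (+-right-comm (i + r) k ℓ) (cong (_+ k) (+-right-comm i r ℓ))) ⟩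
      b (i + ℓ + r + k)       ≡⟨ closed k<s ⟩
      b k                     ≡⟨ rest-below (<-≤-trans k<s (m≤n+m s i)) ⟨
      rest k                  ∎
      where open ≡-Reasoning

    weight-split : ∀ r → weight b (i + ℓ + r) ≡ weight rest (i + r) + weight loop ℓ
    weight-split r = begin
      weight b (i + ℓ + r)                  ≡⟨ trans (trues-+ g (i + ℓ) r) (cong (_+ tail) (trues-+ g i ℓ)) ⟩
      head + middle + tail                  ≡⟨ +-right-comm head middle tail ⟩
      head + tail + middle                  ≡⟨ cong₂ _+_ rest-weight loop-weight ⟨
      weight rest (i + r) + weight loop ℓ   ∎
      where
      open ≡-Reasoning
      g : ℕ → Bool
      g k = b (s + k)
      head   = trues g i
      middle = trues (λ k → g (i + k)) ℓ
      tail   = trues (λ k → g (i + ℓ + k)) r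
      rest-weight : weight rest (i + r) ≡ head + tail
      rest-weight = trans (trues-+ (λ k → rest (s + k)) i r) (cong₂ _+_
        (trues-cong i (λ {k} k<i → rest-below (subst (s + k <_) (+-comm s i) (+-monoʳ-< s k<i))))
        (trues-cong r (λ {k} _ → trans (rest-from (≤-trans (m≤m+n i k) (m≤n+m (i + k) s)))
          (cong b (trans (+-assoc s (i + k) ℓ) (cong (_+_ s) (+-right-comm i k ℓ)))))))
      loop-weight : weight loop ℓ ≡ middle
      loop-weight = trues-cong ℓ (λ {k} _ → cong b (+-left-comm i s k))

  record Split (b : Word) (n ℓ k : ℕ) : Set where
    field
      loop rest    : Word
      loop-closed  : Closed loop ℓ
      loop-covered : CoveredUpTo loop ℓ
      rest-covered : CoveredUpTo rest k
      rest-closed  : Closed b n → Closed rest k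
      weight-split : weight b n ≡ weight rest k + weight loop ℓ

  split-lengths : ∀ {i j n} → i ≤ j → j ≤ n → i + (n ∸ j) + (j ∸ i) ≡ n
  split-lengths {i} {j} {n} i≤j j≤n = begin
    i + (n ∸ j) + (j ∸ i)    ≡⟨ +-right-comm i (n ∸ j) (j ∸ i) ⟩
    i + (j ∸ i) + (n ∸ j)    ≡⟨ cong (_+ (n ∸ j)) (m+[n∸m]≡n i≤j) ⟩
    j + (n ∸ j)              ≡⟨ m+[n∸m]≡n j≤n ⟩
    n                        ∎
    where open ≡-Reasoning

  split : ∀ {b n i j} → i < j → j ≤ n → window b i ≡ window b j → CoveredUpTo b n → Split b n (j ∸ i) (i + (n ∸ j))
  split {b} {n} {i} {j} i<j j≤n window-repeats cov = subst (λ n → Split b n ℓ (i + r)) i+ℓ+r≡n (record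
    { loop         = loop
    ; rest         = rest
    ; loop-closed  = loop-closed
    ; loop-covered = loop-covered (m≤m+n (i + ℓ) r) cov′
    ; rest-covered = rest-covered r cov′
    ; rest-closed  = rest-closed r
    ; weight-split = weight-split r
    })
    where
    ℓ = j ∸ i
    r = n ∸ j
    i+ℓ≡j : i + ℓ ≡ j
    i+ℓ≡j = m+[n∸m]≡n (<⇒≤ i<j)
    i+ℓ+r≡n : i + ℓ + r ≡ n
    i+ℓ+r≡n = trans (cong (_+ r) i+ℓ≡j) (m+[n∸m]≡n j≤n)
    cov′ : CoveredUpTo b (i + ℓ + r)
    cov′ = subst (CoveredUpTo b) (sym i+ℓ+r≡n) cov
    repeat : ∀ {k} → k < s → b (i + k) ≡ b (i + ℓ + k)
    repeat {k} k<s = trans (window-≡⁻ {b} {i} {j} window-repeats k<s) (cong (λ z → b (z + k)) (sym i+ℓ≡j))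
    open Splice b i ℓ repeat

  cycleLength : Cycle s S → ℕ
  cycleLength γ = suc (Cycle.len-1 γ)

  cycleWeight : Cycle s S → ℕ
  cycleWeight γ = count (Cycle.wt γ)

  Repeat : Word → ℕ → Set
  Repeat b n = ∃ λ j → j < n × ∃ λ i → i < j × window b i ≡ window b j

  repeat? : ∀ b n → Dec (Repeat b n)
  repeat? b = anyUpTo? (λ j → anyUpTo? (λ i → ≡-dec Bool._≟_ (window b i) (window b j)) j)

  module _ (m : ℕ) (b : Word) where

    weights : Vec Bool (suc m)
    weights = tabulate (λ i → b (s + toℕ i))

    window-next : Closed b (suc m) → ∀ i → window b (toℕ (next i)) ≡ window b (suc (toℕ i))
    window-next closed i with suc (toℕ i) <? suc m
    ... | yes 1+i<1+m = cong (window b) (trans (toℕ-fromℕ< _) (m<n⇒m%n≡m 1+i<1+m))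
    ... | no  1+i≮1+m = begin
      window b (toℕ (next i))     ≡⟨ cong (window b) (trans (toℕ-fromℕ< _) (cong (_% suc m) 1+i≡1+m)) ⟩
      window b (suc m % suc m)    ≡⟨ cong (window b) (n%n≡0 (suc m)) ⟩
      window b 0                  ≡⟨ window-≡⁺ {b} {0} {suc m} (λ k<s → sym (closed k<s)) ⟩
      window b (suc m)            ≡⟨ cong (window b) 1+i≡1+m ⟨
      window b (suc (toℕ i))      ∎
      where
      open ≡-Reasoning
      1+i≡1+m : suc (toℕ i) ≡ suc m
      1+i≡1+m = ≤-antisym (toℕ<n i) (≮⇒≥ 1+i≮1+m)

    wordCycle : Closed b (suc m) → CoveredUpTo b (suc m) → ¬ Repeat b (suc m) → Cycle s S
    wordCycle closed cov no-repeat = record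
      { len-1    = m
      ; v        = λ i → window b (toℕ i)
      ; wt       = weights
      ; distinct = distinct
      ; edges    = λ i → subst₂ (Edge s S (window b (toℕ i)))
                           (sym (lookup∘tabulate (λ i → b (s + toℕ i)) i)) (sym (window-next closed i))
                           (window-edge b (toℕ i) (cov (toℕ<n i)))
      }
      where
      distinct : ∀ {i j} → window b (toℕ i) ≡ window b (toℕ j) → i ≡ j
      distinct {i} {j} eq with <-cmp (toℕ i) (toℕ j)
      ... | tri< i<j _ _ = ⊥-elim (no-repeat (toℕ j , toℕ<n j , toℕ i , i<j , eq))
      ... | tri≈ _ i≡j _ = toℕ-injective i≡j
      ... | tri> _ _ j<i = ⊥-elim (no-repeat (toℕ i , toℕ<n i , toℕ j , j<i , sym eq))

    weights-count : count weights ≡ weight b (suc m)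
    weights-count = count≡trues weights (lookup∘tabulate (λ i → b (s + toℕ i)))

  split-mediant : ∀ {b n ℓ k} (sp : Split b n ℓ k) → k + ℓ ≡ n →
    weight (Split.rest sp) k ÷ k ≼ weight b n ÷ n ⊎ weight (Split.loop sp) ℓ ÷ ℓ ≼ weight b n ÷ n
  split-mediant {b} {n} {ℓ} {k} sp k+ℓ≡n =
    subst₂ (λ w n → weight rest k ÷ k ≼ w ÷ n ⊎ weight loop ℓ ÷ ℓ ≼ w ÷ n) (sym weight-split) k+ℓ≡n
      (mediant (weight rest k) k (weight loop ℓ) ℓ)
    where open Split sp

  cycle-below : ∀ n → 0 < n → ∀ b → Closed b n → CoveredUpTo b n →
    ∃ λ γ → cycleWeight γ ÷ cycleLength γ ≼ weight b n ÷ n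
  cycle-below = <-rec P below
    where
    P : ℕ → Set
    P n = 0 < n → ∀ b → Closed b n → CoveredUpTo b n → ∃ λ γ → cycleWeight γ ÷ cycleLength γ ≼ weight b n ÷ n
    below : ∀ n → (∀ {n′} → n′ < n → P n′) → P n
    below (suc m) rec _ b closed cov with repeat? b (suc m)
    ... | no no-repeat = wordCycle m b closed cov no-repeat , cross (≤-reflexive (cong (_* suc m) (weights-count m b)))
    ... | yes (j , j<n , i , i<j , eq) = via (split-mediant sp k+ℓ≡n)
      where
      n = suc m
      ℓ = j ∸ i
      k = i + (n ∸ j)
      sp = split {b} i<j (<⇒≤ j<n) eq cov
      open Split sp
      k+ℓ≡n : k + ℓ ≡ n
      k+ℓ≡n = split-lengths (<⇒≤ i<j) (<⇒≤ j<n)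
      0<ℓ : 0 < ℓ
      0<ℓ = m<n⇒0<n∸m i<j
      0<k : 0 < k
      0<k = <-≤-trans (m<n⇒0<n∸m j<n) (m≤n+m (n ∸ j) i)
      via : weight rest k ÷ k ≼ weight b n ÷ n ⊎ weight loop ℓ ÷ ℓ ≼ weight b n ÷ n →
            ∃ λ γ → cycleWeight γ ÷ cycleLength γ ≼ weight b n ÷ n
      via (inj₁ rest≼) with γ , γ≼ ← rec (subst (k <_) k+ℓ≡n (m<m+n k 0<ℓ)) 0<k rest (rest-closed closed) rest-covered =
        γ , ≼-trans k {{>-nonZero 0<k}} γ≼ rest≼
      via (inj₂ loop≼) with γ , γ≼ ← rec (subst (ℓ <_) k+ℓ≡n (m<n+m ℓ 0<k)) 0<ℓ loop loop-closed loop-covered =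
        γ , ≼-trans ℓ {{>-nonZero 0<ℓ}} γ≼ loop≼

  module Unroll (γ : Cycle s S) where
    open Cycle γ

    m : ℕ
    m = cycleLength γ

    index : ℕ → Fin m
    index t = fromℕ< (m%n<n t m)

    index-cong : ∀ t u → t % m ≡ u % m → index t ≡ index u
    index-cong t u eq = toℕ-injective (trans (toℕ-fromℕ< _) (trans eq (sym (toℕ-fromℕ< _))))

    index-zero : index 0 ≡ fzero
    index-zero = toℕ-injective (toℕ-fromℕ< (m%n<n 0 m))

    index-period : ∀ t → index (t + m) ≡ index t
    index-period t = index-cong (t + m) t ([m+n]%n≡m%n t m)

    index-toℕ : ∀ i → index (toℕ i) ≡ i
    index-toℕ i = toℕ-injective (trans (toℕ-fromℕ< _) (m<n⇒m%n≡m (toℕ<n i)))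

    index-suc : ∀ t → index (suc t) ≡ next (index t)
    index-suc t = index-cong (suc t) (suc (toℕ (index t))) (begin
      suc t % m                       ≡⟨ %-distribˡ-+ 1 t m ⟩
      (1 % m + t % m) % m             ≡⟨ cong (λ z → (1 % m + z) % m) (m%n%n≡m%n t m) ⟨
      (1 % m + t % m % m) % m         ≡⟨ %-distribˡ-+ 1 (t % m) m ⟨
      suc (t % m) % m                 ≡⟨ cong (λ z → suc z % m) (toℕ-fromℕ< (m%n<n t m)) ⟨
      suc (toℕ (index t)) % m         ∎)
      where open ≡-Reasoning

    word : Word
    word k with k <? s
    ... | yes p = lookup (v fzero) (fromℕ< p)
    ... | no  _ = lookup wt (index (k ∸ s))

    word-below : ∀ {k} (p : k < s) → word k ≡ lookup (v fzero) (fromℕ< p)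
    word-below {k} p with k <? s
    ... | yes _ = refl
    ... | no k≮s = ⊥-elim (k≮s p)

    word-from : ∀ {k} → s ≤ k → word k ≡ lookup wt (index (k ∸ s))
    word-from {k} s≤k with k <? s
    ... | yes k<s = ⊥-elim (<⇒≱ k<s s≤k)
    ... | no _    = refl

    word-weight : ∀ t → word (s + t) ≡ lookup wt (index t)
    word-weight t = trans (word-from (m≤m+n s t)) (cong (λ z → lookup wt (index z)) (m+n∸m≡n s t))

    window-word : ∀ t {y} (p : y < s) → word (t + y) ≡ lookup (v (index t)) (fromℕ< p)
    window-word zero p = trans (word-below p) (cong (λ i → lookup (v i) (fromℕ< p)) (sym index-zero))
    window-word (suc t) {y} p with suc y <? s
    ... | yes q = begin
      word (suc t + y)                            ≡⟨ cong word (sym (+-suc t y)) ⟩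
      word (t + suc y)                            ≡⟨ window-word t q ⟩
      lookup (v (index t)) (fromℕ< q)             ≡⟨ Shift.shift edge p q ⟨
      lookup (v (next (index t))) (fromℕ< p)      ≡⟨ cong (λ i → lookup (v i) (fromℕ< p)) (index-suc t) ⟨
      lookup (v (index (suc t))) (fromℕ< p)       ∎
      where
      open ≡-Reasoning
      edge = Edge⇒Shift (edges (index t))
    ... | no q = begin
      word (suc t + y)                            ≡⟨ cong word (trans (sym (+-suc t y)) (cong (_+_ t) 1+y≡s)) ⟩
      word (t + s)                                ≡⟨ cong word (+-comm t s) ⟩
      word (s + t)                                ≡⟨ word-weight t ⟩
      lookup wt (index t)                         ≡⟨ Shift.last edge p 1+y≡s ⟨
      lookup (v (next (index t))) (fromℕ< p)      ≡⟨ cong (λ i → lookup (v i) (fromℕ< p)) (index-suc t) ⟨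
      lookup (v (index (suc t))) (fromℕ< p)       ∎
      where
      open ≡-Reasoning
      edge = Edge⇒Shift (edges (index t))
      1+y≡s : suc y ≡ s
      1+y≡s = ≤-antisym p (≮⇒≥ q)

    word-periodic : ∀ k → word (k + m) ≡ word k
    word-periodic k = periodic-at (k <? s)
      where
      periodic-at : Dec (k < s) → word (k + m) ≡ word k
      periodic-at (yes p) = begin
        word (k + m)                               ≡⟨ cong word (+-comm k m) ⟩
        word (m + k)                               ≡⟨ window-word m p ⟩
        lookup (v (index m)) (fromℕ< p)            ≡⟨ cong (λ i → lookup (v i) (fromℕ< p)) (trans (index-period 0) index-zero) ⟩
        lookup (v fzero) (fromℕ< p)                ≡⟨ word-below p ⟨
        word k                                     ∎
        where open ≡-Reasoning
      periodic-at (no k≮s) = begin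
        word (k + m)                               ≡⟨ word-from (≤-trans (≮⇒≥ k≮s) (m≤m+n k m)) ⟩
        lookup wt (index (k + m ∸ s))              ≡⟨ cong (λ z → lookup wt (index z)) (+-∸-comm m (≮⇒≥ k≮s)) ⟩
        lookup wt (index (k ∸ s + m))              ≡⟨ cong (lookup wt) (index-period (k ∸ s)) ⟩
        lookup wt (index (k ∸ s))                  ≡⟨ word-from (≮⇒≥ k≮s) ⟨
        word k                                     ∎
        where open ≡-Reasoning

    word-closed : Closed word m
    word-closed {k} _ = trans (cong word (+-comm m k)) (word-periodic k)

    word-covered : ∀ y → Covered word (s + y)
    word-covered y with lookup wt (index y) in wt[y] | edges (index y)
    ... | true  | _ = 0 , 0∈S , z≤n , trans (word-weight y) wt[y]
    ... | false | (a , a∈v , c , c∈S , 1+s≡a+c) , _ with memN⁻ (v (index y)) a∈v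
    ...   | a′ , refl , p , v[a′] =
      c , c∈S , ≤-trans (∈S⇒≤s c∈S) (m≤m+n s y) , trans (cong word index≡) (trans (window-word y p) v[a′])
      where
      s≡a′+c : s ≡ a′ + c
      s≡a′+c = suc-injective 1+s≡a+c
      index≡ : s + y ∸ c ≡ y + a′
      index≡ = begin
        s + y ∸ c              ≡⟨ cong (λ z → z + y ∸ c) s≡a′+c ⟩
        a′ + c + y ∸ c         ≡⟨ cong (_∸ c) (+-right-comm a′ c y) ⟩
        a′ + y + c ∸ c         ≡⟨ m+n∸n≡m (a′ + y) c ⟩
        a′ + y                 ≡⟨ +-comm a′ y ⟩
        y + a′                 ∎
        where open ≡-Reasoning

    word-weight-cycle : weight word m ≡ cycleWeight γ
    word-weight-cycle = sym (count≡trues wt (λ i → sym (trans (word-weight (toℕ i)) (cong (lookup wt) (index-toℕ i)))))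

    word-density : trues word m ≡ cycleWeight γ
    word-density = trans (sym (trues-window word-periodic s)) word-weight-cycle

    length≤2^s : m ≤ 2 ^ s
    length≤2^s = injective⇒≤2^ v distinct

  -- A cheapest cycle

  agree-closed : ∀ {N f b n} → s + n ≤ N → AgreeBelow N f b → Closed b n → Closed f n
  agree-closed {n = n} s+n≤N f≈b closed {k} k<s =
    trans (f≈b (<-≤-trans (subst (n + k <_) (+-comm n s) (+-monoʳ-< n k<s)) s+n≤N))
          (trans (closed k<s) (sym (f≈b (<-≤-trans k<s (≤-trans (m≤m+n s n) s+n≤N)))))

  agree-covered : ∀ {N f b n} → s + n ≤ N → AgreeBelow N f b → CoveredUpTo b n → CoveredUpTo f n
  agree-covered s+n≤N f≈b cov {y} y<n with c , c∈S , c≤ , b[z] ← cov y<n =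
    c , c∈S , c≤ , trans (f≈b (≤-<-trans (m∸n≤m (s + y) c) (<-≤-trans (+-monoʳ-< s y<n) s+n≤N))) b[z]

  agree-weight : ∀ {N f b} n → s + n ≤ N → AgreeBelow N f b → weight f n ≡ weight b n
  agree-weight n s+n≤N f≈b = trues-cong n (λ k<n → f≈b (<-≤-trans (+-monoʳ-< s k<n) s+n≤N))

  M : ℕ
  M = 2 ^ s

  Admissible : ℕ → Word → Set
  Admissible n b = Closed b n × CoveredUpTo b n

  -- (m , f) stands for the first s + m + 1 letters of f, a closed walk of length m + 1.
  candidates : List (ℕ × Word)
  candidates = cartesianProduct (upTo M) (sequences (s + M))

  module Candidates = Minimum {P = λ (m , f) → Admissible (suc m) f}
    (λ (m , f) → closed? f (suc m) ×-dec coveredUpTo? f (suc m))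
    (λ (m , f) (n , g) → weight f (suc m) ÷ suc m ≼ weight g (suc n) ÷ suc n)
    (λ (m , f) (n , g) → Sum.map cross cross (≤-total _ _))
    (λ {_} {y} → ≼-trans (suc (proj₁ y)))

  candidate-complete : ∀ {n} b → 0 < n → n ≤ M → Admissible n b →
    ∃ λ f → (pred n , f) ∈ candidates × Admissible n f × weight f n ≡ weight b n
  candidate-complete {suc m} b _ n≤M (closed , cov) with f , f∈ , f≈b ← sequences-complete (s + M) b =
    f , ∈-cartesianProduct⁺ (∈-upTo⁺ n≤M) f∈ ,
    (agree-closed s+n≤ f≈b closed , agree-covered s+n≤ f≈b cov) , agree-weight (suc m) s+n≤ f≈b
    where
    s+n≤ : s + suc m ≤ s + M
    s+n≤ = +-monoʳ-≤ s n≤M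

  opaque
    minimal-word : ∃ λ (x : ℕ × Word) → Admissible (suc (proj₁ x)) (proj₂ x) × Candidates.LowerBound candidates x
    minimal-word with f , f∈ , f≈⊤ ← sequences-complete (s + M) (λ _ → true) =
      Candidates.minimum candidates ((0 , f) , ∈-cartesianProduct⁺ (∈-upTo⁺ 1≤M) f∈ ,
        agree-closed (+-monoʳ-≤ s 1≤M) f≈⊤ (λ _ → refl) ,
        agree-covered (+-monoʳ-≤ s 1≤M) f≈⊤ (λ _ → 0 , 0∈S , z≤n , refl))
      where
      1≤M : 1 ≤ M
      1≤M = m^n>0 2 s

  opaque
    minimal-cycle : ∃ λ γ → ∀ {n} b → 0 < n → n ≤ M → Admissible n b →
                      cycleWeight γ ÷ cycleLength γ ≼ weight b n ÷ n
    minimal-cycle with (m , f) , (closed , cov) , f-minimal ← minimal-word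
                  with γ , γ≼f ← cycle-below (suc m) (s≤s z≤n) f closed cov =
      γ , below
      where
      below : ∀ {n} b → 0 < n → n ≤ M → Admissible n b → cycleWeight γ ÷ cycleLength γ ≼ weight b n ÷ n
      below {suc n′} b 0<n n≤M adm with g , g∈ , g-adm , g≡b ← candidate-complete b 0<n n≤M adm =
        ≼-trans (suc m) γ≼f
          (subst (λ w → weight f (suc m) ÷ suc m ≼ w ÷ suc n′) g≡b (f-minimal g∈ g-adm))

  γ₀ : Cycle s S
  γ₀ = proj₁ minimal-cycle

  c₀ m₀ : ℕ
  c₀ = cycleWeight γ₀
  m₀ = cycleLength γ₀

  minimal-ratio : ∀ {n} b → 0 < n → n ≤ M → Admissible n b → c₀ ÷ m₀ ≼ weight b n ÷ n
  minimal-ratio = proj₂ minimal-cycle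

  cycle-ratio-minimal : ∀ γ → c₀ ÷ m₀ ≼ cycleWeight γ ÷ cycleLength γ
  cycle-ratio-minimal γ = subst (λ w → c₀ ÷ m₀ ≼ w ÷ m) word-weight-cycle
    (minimal-ratio word (s≤s z≤n) length≤2^s (word-closed , λ {y} _ → word-covered y))
    where open Unroll γ

  c₀≤m₀ : c₀ ≤ m₀
  c₀≤m₀ = ∣p∣≤n (Cycle.wt γ₀)

  window-repeat : ∀ b → ∃ λ j → j ≤ M × ∃ λ i → i < j × window b i ≡ window b j
  window-repeat b with i , j , i<j , eq ← subset-pigeonhole (n<1+n M) (λ (k : Fin (suc M)) → window b (toℕ k)) =
    toℕ j , ≤-pred (toℕ<n j) , toℕ i , i<j , eq

  weight-lower-bound : ∀ n b → CoveredUpTo b n → c₀ ÷ m₀ ≼ (weight b n + M) ÷ n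
  weight-lower-bound = <-rec P bound
    where
    P : ℕ → Set
    P n = ∀ b → CoveredUpTo b n → c₀ ÷ m₀ ≼ (weight b n + M) ÷ n
    bound : ∀ n → (∀ {n′} → n′ < n → P n′) → P n
    bound n rec b cov with n ≤? M
    ... | yes n≤M = cross (begin
      c₀ * n                   ≤⟨ *-monoˡ-≤ n c₀≤m₀ ⟩
      m₀ * n                   ≤⟨ *-monoʳ-≤ m₀ (≤-trans n≤M (m≤n+m M (weight b n))) ⟩
      m₀ * (weight b n + M)    ≡⟨ *-comm m₀ _ ⟩
      (weight b n + M) * m₀    ∎)
      where open ≤-Reasoning
    ... | no n≰M with j , j≤M , i , i<j , eq ← window-repeat b = cross (begin
      c₀ * n                                           ≡⟨ cong (c₀ *_) k+ℓ≡n ⟨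
      c₀ * (k + ℓ)                                     ≡⟨ *-distribˡ-+ c₀ k ℓ ⟩
      c₀ * k + c₀ * ℓ                                  ≤⟨ +-mono-≤ (cross-≤ rest-bound) (cross-≤ loop-bound) ⟩
      (weight rest k + M) * m₀ + weight loop ℓ * m₀    ≡⟨ regroup (weight rest k) (weight loop ℓ) M m₀ ⟩
      (weight rest k + weight loop ℓ + M) * m₀         ≡⟨ cong (λ w → (w + M) * m₀) weight-split ⟨
      (weight b n + M) * m₀                            ∎)
      where
      open ≤-Reasoning
      j<n : j < n
      j<n = ≤-<-trans j≤M (≰⇒> n≰M)
      ℓ = j ∸ i
      k = i + (n ∸ j)
      open Split (split {b} i<j (<⇒≤ j<n) eq cov)
      k+ℓ≡n : k + ℓ ≡ n
      k+ℓ≡n = split-lengths (<⇒≤ i<j) (<⇒≤ j<n)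
      0<ℓ : 0 < ℓ
      0<ℓ = m<n⇒0<n∸m i<j
      rest-bound : c₀ ÷ m₀ ≼ (weight rest k + M) ÷ k
      rest-bound = rec (subst (k <_) k+ℓ≡n (m<m+n k 0<ℓ)) rest rest-covered
      loop-bound : c₀ ÷ m₀ ≼ weight loop ℓ ÷ ℓ
      loop-bound = minimal-ratio loop 0<ℓ (≤-trans (m∸n≤m j i) j≤M) (loop-closed , loop-covered)
      regroup : ∀ a b M m → (a + M) * m + b * m ≡ (a + b + M) * m
      regroup = solve-∀

  -- Finite subsets of ℤ as words

  position : ℕ → ℤ
  position j = + suc j ℤ.- + s

  position-+ : ∀ {y c} → c ≤ s + y → position (s + y ∸ c) ℤ.+ + c ≡ + suc y
  position-+ {y} {c} c≤ = begin
    + suc z ℤ.- + s ℤ.+ + c        ≡⟨ swap (+ suc z) (+ s) (+ c) ⟩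
    + suc z ℤ.+ + c ℤ.- + s        ≡⟨ cong (λ w → w ℤ.- + s) (sym (ℤₚ.pos-+ (suc z) c)) ⟩
    + suc (z + c) ℤ.- + s          ≡⟨ cong (λ w → + w ℤ.- + s) (trans (cong suc (m∸n+n≡m c≤)) (sym (+-suc s y))) ⟩
    + (s + suc y) ℤ.- + s          ≡⟨ cong (λ w → w ℤ.- + s) (ℤₚ.pos-+ s (suc y)) ⟩
    + s ℤ.+ + suc y ℤ.- + s        ≡⟨ cancel (+ s) (+ suc y) ⟩
    + suc y                        ∎
    where
    open ≡-Reasoning
    z = s + y ∸ c
    swap : ∀ a b c → a ℤ.- b ℤ.+ c ≡ a ℤ.+ c ℤ.- b
    swap = ℤ-solve-∀
    cancel : ∀ a b → a ℤ.+ b ℤ.- a ≡ b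
    cancel = ℤ-solve-∀

  +-cancelʳ-ℤ : ∀ {x y} a → x ℤ.+ a ≡ y ℤ.+ a → x ≡ y
  +-cancelʳ-ℤ {x} {y} a eq = trans (sym (cancel x a)) (trans (cong (ℤ._- a) eq) (cancel y a))
    where
    cancel : ∀ x a → x ℤ.+ a ℤ.- a ≡ x
    cancel = ℤ-solve-∀

  position-injective : ∀ {i j} → position i ≡ position j → i ≡ j
  position-injective eq = suc-injective (ℤₚ.+-injective (+-cancelʳ-ℤ (ℤ.- + s) eq))

  toSet : Word → ℕ → List ℤ
  toSet f zero    = []
  toSet f (suc N) with f N
  ... | true  = position N ∷ toSet f N
  ... | false = toSet f N

  length-toSet : ∀ f N → length (toSet f N) ≡ trues f N
  length-toSet f zero = refl
  length-toSet f (suc N) with f N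
  ... | true  = cong suc (length-toSet f N)
  ... | false = length-toSet f N

  ∈-toSet⁻ : ∀ f N {e} → e ∈ toSet f N → ∃ λ j → j < N × f j ≡ true × e ≡ position j
  ∈-toSet⁻ f (suc N) e∈ with f N in f[N]
  ∈-toSet⁻ f (suc N) (here refl)  | true = N , ≤-refl , f[N] , refl
  ∈-toSet⁻ f (suc N) (there e∈)   | true with j , j<N , f[j] , refl ← ∈-toSet⁻ f N e∈ =
    j , m<n⇒m<1+n j<N , f[j] , refl
  ∈-toSet⁻ f (suc N) e∈           | false with j , j<N , f[j] , refl ← ∈-toSet⁻ f N e∈ =
    j , m<n⇒m<1+n j<N , f[j] , refl

  ∈-toSet⁺ : ∀ f {N j} → j < N → f j ≡ true → position j ∈ toSet f N
  ∈-toSet⁺ f {suc N} {j} j<1+N f[j] with m<1+n⇒m<n∨m≡n j<1+N | f N in f[N]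
  ... | inj₁ j<N  | true  = there (∈-toSet⁺ f j<N f[j])
  ... | inj₁ j<N  | false = ∈-toSet⁺ f j<N f[j]
  ... | inj₂ refl | true  = here refl
  ... | inj₂ refl | false with () ← trans (sym f[j]) f[N]

  toSet-unique : ∀ f N → Unique (toSet f N)
  toSet-unique f zero = []
  toSet-unique f (suc N) with f N
  ... | true  = All.tabulate (λ e∈ eq → new e∈ eq) ∷ toSet-unique f N
    where
    new : ∀ {e} → e ∈ toSet f N → position N ≢ e
    new e∈ refl with j , j<N , _ , eq ← ∈-toSet⁻ f N e∈ = <-irrefl (sym (position-injective eq)) j<N
  ... | false = toSet-unique f N

  toSet-covers : ∀ {f n} → CoveredUpTo f n → Covers (toSet f (s + n)) S n
  toSet-covers {f} {n} cov (suc y) _ y<n with c , c∈S , c≤ , f[z] ← cov y<n =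
    position (s + y ∸ c) , ∈-toSet⁺ f (≤-<-trans (m∸n≤m (s + y) c) (+-monoʳ-< s y<n)) f[z] ,
    c , c∈S , sym (position-+ c≤)

  fromSet : List ℤ → Word
  fromSet T j = does (position j ∈? T)

  fromSet-true⁻ : ∀ T {j} → fromSet T j ≡ true → position j ∈ T
  fromSet-true⁻ T {j} eq with position j ∈? T
  ... | yes p = p

  fromSet-true⁺ : ∀ T {j} → position j ∈ T → fromSet T j ≡ true
  fromSet-true⁺ T {j} p with position j ∈? T
  ... | yes _ = refl
  ... | no ¬p = ⊥-elim (¬p p)

  fromSet-covered : ∀ {T n} → Covers T S n → CoveredUpTo (fromSet T) n
  fromSet-covered {T} cov {y} y<n with t , t∈T , a , a∈S , eq ← cov (suc y) (s≤s z≤n) y<n =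
    a , a∈S , a≤ , fromSet-true⁺ T (subst (_∈ T) (sym position≡t) t∈T)
    where
    a≤ : a ≤ s + y
    a≤ = ≤-trans (∈S⇒≤s a∈S) (m≤m+n s y)
    position≡t : position (s + y ∸ a) ≡ t
    position≡t = +-cancelʳ-ℤ (+ a) (trans (position-+ a≤) eq)

  trues-fromSet : ∀ {T} N → Unique T → trues (fromSet T) N ≤ length T
  trues-fromSet {T} N uniq = subst (_≤ length T) (length-toSet (fromSet T) N)
    (Unique-⊆⇒length≤ (toSet-unique (fromSet T) N) ⊆T)
    where
    ⊆T : ∀ {e} → e ∈ toSet (fromSet T) N → e ∈ T
    ⊆T e∈ with _ , _ , T[j] , refl ← ∈-toSet⁻ (fromSet T) N e∈ = fromSet-true⁻ T T[j]

  module Cheapest (n : ℕ) = Minimum {P = λ f → CoveredUpTo f n} (λ f → coveredUpTo? f n)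
    (λ f g → trues f (s + n) ≤ trues g (s + n)) (λ _ _ → ≤-total _ _) ≤-trans

  tau-exists : ∀ n → ∃ λ k → IsTau S n k
  tau-exists n with f , f∈ , f≈⊤ ← sequences-complete (s + n) (λ _ → true)
               with g , cov , g-minimal ← Cheapest.minimum n (sequences (s + n))
                                            (f , f∈ , agree-covered ≤-refl f≈⊤ (λ _ → 0 , 0∈S , z≤n , refl)) =
    trues g (s + n) ,
    (toSet g (s + n) , toSet-unique g (s + n) , length-toSet g (s + n) , toSet-covers cov) , minimal
    where
    minimal : ∀ T → Unique T → Covers T S n → trues g (s + n) ≤ length T
    minimal T uniq covT with h , h∈ , h≈T ← sequences-complete (s + n) (fromSet T) = begin
      trues g (s + n)              ≤⟨ g-minimal h∈ (agree-covered ≤-refl h≈T (fromSet-covered covT)) ⟩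
      trues h (s + n)              ≡⟨ trues-cong (s + n) h≈T ⟩
      trues (fromSet T) (s + n)    ≤⟨ trues-fromSet (s + n) uniq ⟩
      length T                     ∎
      where open ≤-Reasoning

  tau-lower : ∀ {n k} → IsTau S n k → c₀ ÷ m₀ ≼ (k + M) ÷ n
  tau-lower {n} {k} ((T , uniq , refl , covT) , _) = cross (begin
    c₀ * n                                ≤⟨ cross-≤ (weight-lower-bound n (fromSet T) (fromSet-covered covT)) ⟩
    (weight (fromSet T) n + M) * m₀       ≤⟨ *-monoˡ-≤ m₀ (+-monoˡ-≤ M weight≤k) ⟩
    (length T + M) * m₀                   ∎)
    where
    open ≤-Reasoning
    weight≤k : weight (fromSet T) n ≤ length T
    weight≤k = begin
      weight (fromSet T) n                           ≤⟨ m≤n+m _ _ ⟩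
      trues (fromSet T) s + weight (fromSet T) n     ≡⟨ trues-+ (fromSet T) s n ⟨
      trues (fromSet T) (s + n)                      ≤⟨ trues-fromSet (s + n) uniq ⟩
      length T                                       ∎

  open Unroll γ₀ using (word; word-periodic; word-covered; word-density)

  tau-upper : ∀ {n k} → IsTau S n k → k ≤ trues word (s + n)
  tau-upper {n} (_ , minimal) = subst (_ ≤_) (length-toSet word (s + n))
    (minimal (toSet word (s + n)) (toSet-unique word (s + n)) (toSet-covers (λ {y} _ → word-covered y)))

  C : ℕ
  C = s + m₀ + M

  tau-distance : ∀ {n k} → IsTau S n k → ℤ.∣ k * m₀ ⊖ c₀ * n ∣ ≤ m₀ * C
  tau-distance {n} {k} isTau = ∣⊖∣≤ above below
    where
    open ≤-Reasoning
    above : k * m₀ ≤ c₀ * n + m₀ * C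
    above = begin
      k * m₀                            ≡⟨ *-comm k m₀ ⟩
      m₀ * k                            ≤⟨ *-monoʳ-≤ m₀ (tau-upper isTau) ⟩
      m₀ * trues word (s + n)           ≤⟨ trues-periodic-≤ word-periodic (s + n) ⟩
      trues word m₀ * (s + n + m₀)      ≡⟨ cong (λ c → c * (s + n + m₀)) word-density ⟩
      c₀ * (s + n + m₀)                 ≡⟨ regroup c₀ s n m₀ ⟩
      c₀ * n + c₀ * (s + m₀)            ≤⟨ +-monoʳ-≤ (c₀ * n) (*-mono-≤ c₀≤m₀ (m≤m+n (s + m₀) M)) ⟩
      c₀ * n + m₀ * C                   ∎
      where
      regroup : ∀ c s n m → c * (s + n + m) ≡ c * n + c * (s + m)
      regroup = solve-∀
    below : c₀ * n ≤ k * m₀ + m₀ * C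
    below = begin
      c₀ * n                            ≤⟨ cross-≤ (tau-lower isTau) ⟩
      (k + M) * m₀                      ≡⟨ *-distribʳ-+ m₀ k M ⟩
      k * m₀ + M * m₀                   ≤⟨ +-monoʳ-≤ (k * m₀) (≤-reflexive (*-comm M m₀)) ⟩
      k * m₀ + m₀ * M                   ≤⟨ +-monoʳ-≤ (k * m₀) (*-monoʳ-≤ m₀ (m≤n+m M (s + m₀))) ⟩
      k * m₀ + m₀ * C                   ∎

  L : ℕ
  L = Cycle.len-1 γ₀

  α : ℚ
  α = (+ c₀) / m₀

  α-min-ratio : IsMinRatio s S α
  α-min-ratio = (γ₀ , refl) , λ γ → fraction-≤ c₀ L (cycleWeight γ) (Cycle.len-1 γ) (cycle-ratio-minimal γ)

  τ≡α : TauEquals S α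
  τ≡α = (λ n → tau-exists (suc n)) , fractions-converge c₀ L C (λ n k → IsTau S (suc n) k) tau-distance

  -- The periodic covering of ℤ

  open PeriodicExtension word L word-periodic public using (extend; extend-periodic; extend-multiple)

  sumset-at : ∀ x q N → x ℤ.+ + (q * m₀) ≡ + N → s ≤ N →
              ∃ λ t → extend t ≡ true × ∃ λ a → a ∈ S × x ≡ t ℤ.+ + a
  sumset-at x q N x+qm≡N s≤N
    with c , c∈S , c≤N , word[N∸c] ← subst (Covered word) (m+[n∸m]≡n s≤N) (word-covered (N ∸ s)) =
    x ℤ.- + c , extend≡true , c , c∈S , sym (cancel x (+ c))
    where
    open ≡-Reasoning
    cancel : ∀ x c → x ℤ.- c ℤ.+ c ≡ x
    cancel = ℤ-solve-∀
    swap : ∀ x c a → x ℤ.- c ℤ.+ a ≡ x ℤ.+ a ℤ.- c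
    swap = ℤ-solve-∀
    extend≡true : extend (x ℤ.- + c) ≡ true
    extend≡true = begin
      extend (x ℤ.- + c)                   ≡⟨ extend-multiple q (x ℤ.- + c) ⟨
      extend (x ℤ.- + c ℤ.+ + (q * m₀))    ≡⟨ cong extend (swap x (+ c) (+ (q * m₀))) ⟩
      extend (x ℤ.+ + (q * m₀) ℤ.- + c)    ≡⟨ cong (λ y → extend (y ℤ.- + c)) x+qm≡N ⟩
      extend (+ N ℤ.- + c)                 ≡⟨ cong extend (trans (ℤₚ.m-n≡m⊖n N c) (ℤₚ.⊖-≥ c≤N)) ⟩
      word (N ∸ c)                         ≡⟨ word[N∸c] ⟩
      true                                 ∎

  extend-sumset : SumsetIsZ extend S
  extend-sumset (+ n)      = sumset-at (+ n) s (n + s * m₀) refl (≤-trans (m≤m*n s m₀) (m≤n+m _ n))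
  extend-sumset ℤ.-[1+ n ] = sumset-at ℤ.-[1+ n ] q (q * m₀ ∸ suc n) (ℤₚ.⊖-≥ 1+n≤qm) s≤
    where
    q = suc n + s
    1+n≤qm : suc n ≤ q * m₀
    1+n≤qm = ≤-trans (m≤m+n (suc n) s) (m≤m*n q m₀)
    s≤ : s ≤ q * m₀ ∸ suc n
    s≤ = subst (_≤ q * m₀ ∸ suc n) (m+n∸m≡n (suc n) s) (∸-monoˡ-≤ (suc n) (m≤m*n q m₀))

  extend-density : density extend L ≡ α
  extend-density = cong (λ c → (+ c) / m₀) (trans (countUpTo≡trues extend m₀) word-density)

theorem5p1 : (s : ℕ) → 1 ≤ s → (S : List ℕ) → All (_≤ s) S → 0 ∈ S →
    Σ ℚ λ α → IsMinRatio s S α × TauEquals S α ×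
      Σ (ℤ → Bool) λ T → Σ ℕ λ p →
        Periodic T (suc p) × SumsetIsZ T S × density T p ≡ α
theorem5p1 s 1≤s S S≤s 0∈S =
  α , α-min-ratio , τ≡α , extend , L , extend-periodic , extend-sumset , extend-density
  where open Covering s 1≤s S S≤s 0∈S
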